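{- Any (possibly randomized) PSA for $FVS(k)$ requires $\Omega(n)$ space, where $n$ is the number of vertices of the graph; this holds already for $k=0$ and, more generally, for every constant $k$.
   Context: Feedback Vertex Set $FVS(k)$: given a graph $G=(V,E)$ and an integer $k$, decide whether there is a set $V'\subseteq V$ with $|V'|\le k$ such that $G\setminus V'$ has no cycles. A PSA (parameterized streaming algorithm) is a one-pass streaming algorithm over an insertion-only stream of edges that maintains a sketch (memory) from which it answers the question for the current graph; its space is the size of this memory. -}

module Defs where

open import Data.Nat using (ℕ; _≤_; _*_; _^_)
open import Data.Fin using (Fin)
open import Data.Bool using (Bool; true; false)
open import Data.List using (List; []; _∷_; _++_; [_]; length; foldl)
open import Data.List.Membership.Propositional using (_∈_)
open import Data.List.Relation.Unary.All using (All)
open import Data.List.Relation.Unary.Any using (Any)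
open import Data.List.Relation.Unary.AllPairs using (AllPairs)
open import Data.List.Relation.Unary.Linked using (Linked)
open import Data.List.Relation.Unary.Unique.Propositional using (Unique)
open import Data.Product using (Σ; ∃; _×_; _,_)
open import Data.Sum using (_⊎_)
open import Relation.Binary.PropositionalEquality using (_≡_; _≢_)
open import Relation.Nullary using (¬_)

-- An edge on vertex set Fin n, given as an (unordered) pair.
Edge : ℕ → Set
Edge n = Fin n × Fin n

-- A stream of edges (insertion-only); the current graph is the set of edges seen so far.
Stream : ℕ → Set
Stream n = List (Edge n)

SameEdge : ∀ {n} → Edge n → Edge n → Set
SameEdge (a , b) (c , d) = (a ≡ c × b ≡ d) ⊎ (a ≡ d × b ≡ c)

ValidStream : ∀ {n} → Stream n → Set
ValidStream σ = All (λ { (u , v) → u ≢ v }) σ × AllPairs (λ e f → ¬ SameEdge e f) σ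

Adj : ∀ {n} → Stream n → Fin n → Fin n → Set
Adj E u v = ((u , v) ∈ E) ⊎ ((v , u) ∈ E)

record Cycle {n : ℕ} (E : Stream n) (vs : List (Fin n)) : Set where
  field
    head      : Fin n
    rest      : List (Fin n)
    shape     : vs ≡ head ∷ rest
    long      : 3 ≤ length vs
    distinct  : Unique vs
    closedWalk : Linked (Adj E) (vs ++ [ head ])

HasCycleAvoiding : ∀ {n} → Stream n → List (Fin n) → Set
HasCycleAvoiding {n} E V' =
  Σ (List (Fin n)) λ vs → Cycle E vs × All (λ v → ¬ (v ∈ V')) vs

FVS : ∀ {n} → ℕ → Stream n → Set
FVS {n} k E = Σ (List (Fin n)) λ V' → length V' ≤ k × ¬ HasCycleAvoiding E V'

CorrectAnswer : ∀ {n} → ℕ → Stream n → Bool → Set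
CorrectAnswer k E b = (b ≡ true → FVS k E) × (b ≡ false → ¬ FVS k E)

-- A randomized one-pass streaming algorithm on n-vertex graphs with s bits of memory
-- (the memory takes at most 2^s states) and random seed drawn uniformly from Fin R
-- (R ≥ 1; randomness is not charged to the space, i.e. public coins).
record RandStreamAlg (n s R : ℕ) : Set where
  field
    init   : Fin R → Fin (2 ^ s)
    update : Fin R → Fin (2 ^ s) → Edge n → Fin (2 ^ s)
    answer : Fin R → Fin (2 ^ s) → Bool

  run : Fin R → Stream n → Fin (2 ^ s)
  run r σ = foldl (update r) (init r) σ

open RandStreamAlg public

-- The algorithm solves FVS(k) with success probability ≥ 2/3 on every valid stream
-- (for every valid stream, hence for every prefix = current graph): there is a set of
-- distinct seeds of size ≥ 2R/3 on which the answer after reading σ is correct.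
SolvesFVS : ∀ {n s R} → ℕ → RandStreamAlg n s R → Set
SolvesFVS {n} {s} {R} k A =
  ∀ (σ : Stream n) → ValidStream σ →
    Σ (List (Fin R)) λ good →
      Unique good × 2 * R ≤ 3 * length good
      × All (λ r → CorrectAnswer k σ (answer A r (run A r σ))) good

module Submission where

-- The proof is a reduction from the one-way communication problem INDEX.  For
-- x ∈ {0,1}^m and a position i₀ we build a graph on 3m(k+1) vertices made of k+1
-- copies of m potential triangles (module Gadget).  Alice's part of the stream
-- contains, in every copy, the edge 0–1 of triangle i whenever x i = 1; Bob's part
-- adds the edges 1–2 and 2–0 of triangle i₀.  If x i₀ = 1 the graph contains k+1
-- vertex-disjoint triangles, so it has no feedback vertex set of size k; if x i₀ = 0
-- it is a forest.  Hence a PSA with s bits of memory yields a public-coin protocol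
-- with 2^s messages that recovers each bit x i₀ with error probability at most 1/3
-- (module Reduction).
--
-- The INDEX lower bound (index-lower-bound) fixes a seed with few errors in total,
-- uses Markov's inequality to find 2^m/6 inputs decoded with at most 14u wrong bits
-- (m = 35u), and bounds the number of such inputs by weighing x with 3 per bit agreeing
-- with the decoded word and 2 per bit disagreeing: a Hamming ball of radius d then has
-- at most (3/2)^d (5/3)^m points.  This gives u ≤ s + 3, and u = ⌊n / 105(k+1)⌋ yields
-- n ≤ 315 (k+1) s as soon as n ≥ 525 (k+1).

open import Defs
open import Data.Nat
open import Data.Nat.Properties
open import Data.Nat.DivMod using (m/n*n≤m; m*n/n≡m; /-monoˡ-≤; m≡m%n+[m/n]*n; m%n<n)
open import Data.Nat.Tactic.RingSolver using (solve-∀)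
open import Data.Fin as Fin using (Fin; zero; suc)
open import Data.Fin.Properties using (any?; combine-injective; inject≤-injective; pigeonhole)
  renaming (<-irrefl to <-irreflᶠ)
open import Data.Fin.Patterns using (0F; 1F; 2F)
open import Data.Vec using (Vec; []; _∷_; lookup)
open import Data.Vec.Functional using (updateAt)
open import Data.Vec.Functional.Properties using (updateAt-updates; updateAt-minimal)
open import Data.Bool using (Bool; true; false; T; not)
open import Data.Bool.Properties using (T?)
open import Data.Product using (Σ; ∃; _×_; _,_; proj₁; proj₂)
open import Data.Sum using (_⊎_; inj₁; inj₂)
import Data.List as List
open import Data.List using (List; []; _∷_; _++_; [_]; map; filter; cartesianProduct; allFin; length; foldl)
open import Data.List.Membership.Propositional using (_∈_)
open import Data.List.Membership.Propositional.Properties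
  using (∈-cartesianProduct⁺; ∈-allFin; ∈-filter⁺; ∈-filter⁻; ∈-map⁺; ∈-map∘filter⁻; ∈-++⁺ˡ; ∈-++⁺ʳ; ∈-++⁻)
open import Data.List.Properties using (map-++; foldl-++)
import Data.List.Relation.Unary.All as All
import Data.List.Relation.Unary.All.Properties as All
import Data.List.Relation.Unary.AllPairs as AllPairs
import Data.List.Relation.Unary.AllPairs.Properties as AllPairs
open import Data.List.Relation.Unary.Unique.Propositional using (Unique)
import Data.List.Relation.Unary.Unique.Propositional.Properties as Unique
open import Data.List.Relation.Unary.Any using (here; there; index)
open import Data.List.Relation.Unary.Any.Properties using (lookup-index)
open import Data.List.Relation.Unary.All using (All; []; _∷_)
open import Data.List.Relation.Unary.Linked using (Linked; [-]; _∷_)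
open import Data.List.Relation.Unary.AllPairs using ([]; _∷_)
open import Function using (_∘_)
open import Relation.Binary.PropositionalEquality hiding ([_])
open import Data.Empty using (⊥; ⊥-elim)
open import Relation.Nullary using (¬_; Dec; yes; no; contradiction)
open import Relation.Nullary.Decidable using (⌊_⌋; toWitness; fromWitness)
open import Data.Unit using (tt)
open import Algebra.Properties.Semiring.Sum +-*-semiring
  using (sum; sum-syntax; sum-cong-≗; ∑-distrib-+; ∑-comm; *-distribˡ-sum)
open import Algebra.Properties.CommutativeSemigroup +-commutativeSemigroup
  using () renaming (interchange to +-interchange)

∑-mono : ∀ {n} {f g : Fin n → ℕ} → (∀ i → f i ≤ g i) → sum f ≤ sum g
∑-mono {zero} f≤g = z≤n
∑-mono {suc n} f≤g = +-mono-≤ (f≤g zero) (∑-mono (f≤g ∘ suc))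

∑-const : ∀ n c → ∑[ i < n ] c ≡ n * c
∑-const zero c = refl
∑-const (suc n) c = cong (c +_) (∑-const n c)

term≤∑ : ∀ {n} (f : Fin n → ℕ) i → f i ≤ sum f
term≤∑ f zero = m≤m+n _ _
term≤∑ f (suc i) = ≤-trans (term≤∑ (f ∘ suc) i) (m≤n+m _ _)

averaging : ∀ R (g : Fin (suc R) → ℕ) B → sum g ≤ suc R * B → ∃ λ r → g r ≤ B
averaging R g B total with any? (λ r → g r ≤? B)
... | yes found = found
... | no none = contradiction total (<⇒≱ (begin-strict
  suc R * B        <⟨ *-monoʳ-< (suc R) (n<1+n B) ⟩
  suc R * suc B    ≡⟨ ∑-const (suc R) (suc B) ⟨
  ∑[ r < suc R ] suc B ≤⟨ ∑-mono (λ r → ≰⇒> (λ le → none (r , le))) ⟩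
  sum g            ∎))
  where open ≤-Reasoning

∑cube : (m : ℕ) → (Vec Bool m → ℕ) → ℕ
∑cube zero f = f []
∑cube (suc m) f = ∑cube m (f ∘ (false ∷_)) + ∑cube m (f ∘ (true ∷_))

∑cube-mono : ∀ m {f g : Vec Bool m → ℕ} → (∀ x → f x ≤ g x) → ∑cube m f ≤ ∑cube m g
∑cube-mono zero f≤g = f≤g []
∑cube-mono (suc m) f≤g = +-mono-≤ (∑cube-mono m (f≤g ∘ (false ∷_))) (∑cube-mono m (f≤g ∘ (true ∷_)))

∑cube-cong : ∀ m {f g : Vec Bool m → ℕ} → (∀ x → f x ≡ g x) → ∑cube m f ≡ ∑cube m g
∑cube-cong zero f≡g = f≡g []
∑cube-cong (suc m) f≡g = cong₂ _+_ (∑cube-cong m (f≡g ∘ (false ∷_))) (∑cube-cong m (f≡g ∘ (true ∷_)))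

∑cube-+ : ∀ m (f g : Vec Bool m → ℕ) → ∑cube m (λ x → f x + g x) ≡ ∑cube m f + ∑cube m g
∑cube-+ zero f g = refl
∑cube-+ (suc m) f g = begin
  ∑cube m (λ x → f (false ∷ x) + g (false ∷ x)) + ∑cube m (λ x → f (true ∷ x) + g (true ∷ x))
    ≡⟨ cong₂ _+_ (∑cube-+ m _ _) (∑cube-+ m _ _) ⟩
  (f₀ + g₀) + (f₁ + g₁) ≡⟨ +-interchange f₀ g₀ f₁ g₁ ⟩
  (f₀ + f₁) + (g₀ + g₁) ∎
  where
  open ≡-Reasoning
  f₀ f₁ g₀ g₁ : ℕ
  f₀ = ∑cube m (f ∘ (false ∷_))
  f₁ = ∑cube m (f ∘ (true ∷_))
  g₀ = ∑cube m (g ∘ (false ∷_))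
  g₁ = ∑cube m (g ∘ (true ∷_))

∑cube-* : ∀ m c (f : Vec Bool m → ℕ) → ∑cube m (λ x → c * f x) ≡ c * ∑cube m f
∑cube-* zero c f = refl
∑cube-* (suc m) c f = trans (cong₂ _+_ (∑cube-* m c _) (∑cube-* m c _)) (sym (*-distribˡ-+ c _ _))

∑cube-const : ∀ m c → ∑cube m (λ _ → c) ≡ 2 ^ m * c
∑cube-const zero c = sym (+-identityʳ c)
∑cube-const (suc m) c = begin
  ∑cube m (λ _ → c) + ∑cube m (λ _ → c) ≡⟨ cong (λ t → t + t) (∑cube-const m c) ⟩
  2 ^ m * c + 2 ^ m * c                 ≡⟨ cong (2 ^ m * c +_) (sym (+-identityʳ _)) ⟩
  2 * (2 ^ m * c)                       ≡⟨ *-assoc 2 (2 ^ m) c ⟨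
  2 ^ suc m * c                         ∎
  where open ≡-Reasoning

∑cube-∑-comm : ∀ m n (f : Vec Bool m → Fin n → ℕ) →
  ∑cube m (λ x → ∑[ i < n ] f x i) ≡ ∑[ i < n ] ∑cube m (λ x → f x i)
∑cube-∑-comm zero n f = refl
∑cube-∑-comm (suc m) n f =
  trans (cong₂ _+_ (∑cube-∑-comm m n _) (∑cube-∑-comm m n _))
        (sym (∑-distrib-+ (λ i → ∑cube m (λ x → f (false ∷ x) i)) (λ i → ∑cube m (λ x → f (true ∷ x) i))))

-- Hamming balls are small: a weighting argument

mismatch : Bool → Bool → ℕ
mismatch false false = 0
mismatch true  true  = 0
mismatch false true  = 1
mismatch true  false = 1

mismatch-refl : ∀ b → mismatch b b ≡ 0
mismatch-refl false = refl
mismatch-refl true = refl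

mismatch≤1 : ∀ b b′ → mismatch b b′ ≤ 1
mismatch≤1 false false = z≤n
mismatch≤1 true  true  = z≤n
mismatch≤1 false true  = ≤-refl
mismatch≤1 true  false = ≤-refl

hamming : ∀ {m} → (Fin m → Bool) → Vec Bool m → ℕ
hamming {m} a x = ∑[ i < m ] mismatch (a i) (lookup x i)

-- Relative to a fixed word a, each coordinate of x weighs 3 if it agrees with a and 2 if
-- not; the weight of x is the product, i.e. 3^(m - hamming a x) * 2^(hamming a x).
bitWeight : Bool → Bool → ℕ
bitWeight b b′ with mismatch b b′
... | zero = 3
... | suc _ = 2

weight : ∀ {m} → (Fin m → Bool) → Vec Bool m → ℕ
weight {zero} a [] = 1
weight {suc m} a (b ∷ x) = bitWeight (a zero) b * weight (a ∘ suc) x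

-- The total weight of the cube is (3 + 2)^m.
∑cube-weight : ∀ m (a : Fin m → Bool) → ∑cube m (weight a) ≡ 5 ^ m
∑cube-weight zero a = refl
∑cube-weight (suc m) a = begin
  ∑cube m (λ x → w₀ * weight a′ x) + ∑cube m (λ x → w₁ * weight a′ x)
    ≡⟨ cong₂ _+_ (∑cube-* m w₀ (weight a′)) (∑cube-* m w₁ (weight a′)) ⟩
  w₀ * ∑cube m (weight a′) + w₁ * ∑cube m (weight a′) ≡⟨ *-distribʳ-+ _ w₀ w₁ ⟨
  (w₀ + w₁) * ∑cube m (weight a′)                     ≡⟨ cong₂ _*_ (bitWeights (a zero)) (∑cube-weight m a′) ⟩
  5 * 5 ^ m                                           ∎
  where
  open ≡-Reasoning
  a′ : Fin m → Bool
  a′ = a ∘ suc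
  w₀ w₁ : ℕ
  w₀ = bitWeight (a zero) false
  w₁ = bitWeight (a zero) true
  bitWeights : ∀ b → bitWeight b false + bitWeight b true ≡ 5
  bitWeights false = refl
  bitWeights true = refl

weight-hamming : ∀ {m} (a : Fin m → Bool) x →
  weight a x * 3 ^ hamming a x ≡ 2 ^ hamming a x * 3 ^ m
weight-hamming {zero} a [] = refl
weight-hamming {suc m} a (b ∷ x) = begin
  w * W * 3 ^ (e + D)            ≡⟨ cong (w * W *_) (^-distribˡ-+-* 3 e D) ⟩
  w * W * (3 ^ e * 3 ^ D)        ≡⟨ [m*n]*[o*p]≡[m*o]*[n*p] w W (3 ^ e) (3 ^ D) ⟩
  w * 3 ^ e * (W * 3 ^ D)        ≡⟨ cong₂ _*_ (bit (a zero) b) (weight-hamming (a ∘ suc) x) ⟩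
  2 ^ e * 3 * (2 ^ D * 3 ^ m)    ≡⟨ [m*n]*[o*p]≡[m*o]*[n*p] (2 ^ e) 3 (2 ^ D) (3 ^ m) ⟩
  2 ^ e * 2 ^ D * (3 * 3 ^ m)    ≡⟨ cong (_* 3 ^ suc m) (^-distribˡ-+-* 2 e D) ⟨
  2 ^ (e + D) * 3 ^ suc m        ∎
  where
  open ≡-Reasoning
  w e W D : ℕ
  w = bitWeight (a zero) b
  e = mismatch (a zero) b
  W = weight (a ∘ suc) x
  D = hamming (a ∘ suc) x
  bit : ∀ b b′ → bitWeight b b′ * 3 ^ mismatch b b′ ≡ 2 ^ mismatch b b′ * 3
  bit false false = refl
  bit true  true  = refl
  bit false true  = refl
  bit true  false = refl

-- Points of the Hamming ball of radius d around a are heavy: 2^d 3^m ≤ 3^d * weight.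
-- Together with ∑cube-weight this bounds the ball's size by (3/2)^d (5/3)^m.
ball-weight : ∀ {m} (a : Fin m → Bool) x d → hamming a x ≤ d → 2 ^ d * 3 ^ m ≤ 3 ^ d * weight a x
ball-weight {m} a x d D≤d = begin
  2 ^ d * 3 ^ m            ≡⟨ cong (λ t → 2 ^ t * 3 ^ m) d≡D+e ⟩
  2 ^ (D + e) * 3 ^ m      ≡⟨ cong (_* 3 ^ m) (^-distribˡ-+-* 2 D e) ⟩
  2 ^ D * 2 ^ e * 3 ^ m    ≡⟨ regroup (2 ^ D) (2 ^ e) (3 ^ m) ⟩
  2 ^ e * (2 ^ D * 3 ^ m)  ≤⟨ *-monoˡ-≤ (2 ^ D * 3 ^ m) (^-monoˡ-≤ e (s≤s (s≤s z≤n))) ⟩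
  3 ^ e * (2 ^ D * 3 ^ m)  ≡⟨ cong (3 ^ e *_) (weight-hamming a x) ⟨
  3 ^ e * (W * 3 ^ D)      ≡⟨ regroup′ (3 ^ e) W (3 ^ D) ⟩
  3 ^ D * 3 ^ e * W        ≡⟨ cong (_* W) (^-distribˡ-+-* 3 D e) ⟨
  3 ^ (D + e) * W          ≡⟨ cong (λ t → 3 ^ t * W) d≡D+e ⟨
  3 ^ d * W                ∎
  where
  open ≤-Reasoning
  D W e : ℕ
  D = hamming a x
  W = weight a x
  e = d ∸ D
  d≡D+e : d ≡ D + e
  d≡D+e = sym (m+[n∸m]≡n D≤d)
  regroup : ∀ p q r → p * q * r ≡ q * (p * r)
  regroup = solve-∀
  regroup′ : ∀ p q r → p * (q * r) ≡ r * p * q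
  regroup′ = solve-∀

-- Lower bound for one-way protocols for the INDEX problem

near far : ℕ → ℕ → ℕ
near d D with D ≤? d
... | yes _ = 1
... | no  _ = 0
far d D with D ≤? d
... | yes _ = 0
... | no  _ = 1

near+far : ∀ d D → near d D + far d D ≡ 1
near+far d D with D ≤? d
... | yes _ = refl
... | no  _ = refl

far-markov : ∀ d D → far d D * suc d ≤ D
far-markov d D with D ≤? d
... | yes _ = z≤n
... | no D≰d = ≤-trans (≤-reflexive (+-identityʳ (suc d))) (≰⇒> D≰d)

near-bound : ∀ d D {X Y} → (D ≤ d → X ≤ Y) → near d D * X ≤ Y
near-bound d D {X} bound with D ≤? d
... | yes D≤d = ≤-trans (≤-reflexive (+-identityʳ X)) (bound D≤d)
... | no  _   = z≤n

-- A deterministic one-way protocol: x is compressed to one of N messages S x, from which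
-- the word c (S x) is decoded as a guess for x.  dist x is the number of wrongly decoded bits.
module Decoding {m N : ℕ} (S : Vec Bool m → Fin N) (c : Fin N → Fin m → Bool) where

  dist : Vec Bool m → ℕ
  dist x = hamming (c (S x)) x

  nearCount farCount : ℕ → ℕ
  nearCount d = ∑cube m (λ x → near d (dist x))
  farCount d = ∑cube m (λ x → far d (dist x))

  near+farCount : ∀ d → nearCount d + farCount d ≡ 2 ^ m
  near+farCount d = begin
    nearCount d + farCount d                       ≡⟨ ∑cube-+ m _ _ ⟨
    ∑cube m (λ x → near d (dist x) + far d (dist x)) ≡⟨ ∑cube-cong m (λ x → near+far d (dist x)) ⟩
    ∑cube m (λ _ → 1)                              ≡⟨ ∑cube-const m 1 ⟩
    2 ^ m * 1                                      ≡⟨ *-identityʳ _ ⟩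
    2 ^ m                                          ∎
    where open ≡-Reasoning

  farCount-markov : ∀ d → farCount d * suc d ≤ ∑cube m dist
  farCount-markov d = begin
    farCount d * suc d                         ≡⟨ *-comm (farCount d) (suc d) ⟩
    suc d * farCount d                         ≡⟨ ∑cube-* m (suc d) _ ⟨
    ∑cube m (λ x → suc d * far d (dist x))     ≤⟨ ∑cube-mono m (λ x → ≤-trans (≤-reflexive (*-comm (suc d) _)) (far-markov d (dist x))) ⟩
    ∑cube m dist                               ∎
    where open ≤-Reasoning

  -- Only few inputs are decoded well: they lie in N balls of radius d, each of total
  -- weight at most 5^m, while each of their points weighs at least (2/3)^d 3^m.
  nearCount-bound : ∀ d → nearCount d * (2 ^ d * 3 ^ m) ≤ 3 ^ d * (N * 5 ^ m)
  nearCount-bound d = begin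
    nearCount d * X                              ≡⟨ *-comm (nearCount d) X ⟩
    X * nearCount d                              ≡⟨ ∑cube-* m X _ ⟨
    ∑cube m (λ x → X * near d (dist x))          ≤⟨ ∑cube-mono m near-heavy ⟩
    ∑cube m (λ x → 3 ^ d * allWeights x)         ≡⟨ ∑cube-* m (3 ^ d) allWeights ⟩
    3 ^ d * ∑cube m allWeights                   ≡⟨ cong (3 ^ d *_) (∑cube-∑-comm m N (λ x w → weight (c w) x)) ⟩
    3 ^ d * (∑[ w < N ] ∑cube m (weight (c w)))  ≡⟨ cong (3 ^ d *_) (sum-cong-≗ (λ w → ∑cube-weight m (c w))) ⟩
    3 ^ d * (∑[ w < N ] (5 ^ m))                 ≡⟨ cong (3 ^ d *_) (∑-const N (5 ^ m)) ⟩
    3 ^ d * (N * 5 ^ m)                          ∎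
    where
    open ≤-Reasoning
    X : ℕ
    X = 2 ^ d * 3 ^ m
    allWeights : Vec Bool m → ℕ
    allWeights x = ∑[ w < N ] weight (c w) x
    near-heavy : ∀ x → X * near d (dist x) ≤ 3 ^ d * allWeights x
    near-heavy x = ≤-trans (≤-reflexive (*-comm X _)) (near-bound d (dist x) (λ close →
      ≤-trans (ball-weight (c (S x)) x d close) (*-monoʳ-≤ (3 ^ d) (term≤∑ (λ w → weight (c w) x) (S x)))))

-- If on average at most m/3 bits are decoded wrongly (m = 35u), then by Markov's inequality
-- at most 5/6 of the inputs have more than 14u errors.
mostly-near : ∀ u {N} (S : Vec Bool (35 * suc u) → Fin N) c → let open Decoding S c in
  3 * ∑cube (35 * suc u) dist ≤ 2 ^ (35 * suc u) * (35 * suc u) →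
  2 ^ (35 * suc u) ≤ 6 * nearCount (14 * suc u)
mostly-near u S c avgErrors = +-cancelʳ-≤ (6 * F) P (6 * G) (begin
  P + 6 * F      ≤⟨ +-monoʳ-≤ P six-far ⟩
  P + 5 * P      ≡⟨ six-times P ⟩
  6 * P          ≡⟨ cong (6 *_) (near+farCount d) ⟨
  6 * (G + F)    ≡⟨ *-distribˡ-+ 6 G F ⟩
  6 * G + 6 * F  ∎)
  where
  open Decoding S c
  open ≤-Reasoning
  v m d P G F : ℕ
  v = suc u
  m = 35 * v
  d = 14 * v
  P = 2 ^ m
  G = nearCount d
  F = farCount d
  six-times : ∀ p → p + 5 * p ≡ 6 * p
  six-times = solve-∀
  regroup : ∀ f v → 3 * f + 6 * f * (7 * v) ≡ 3 * (f * (1 + 14 * v))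
  regroup = solve-∀
  regroup′ : ∀ p v → p * (35 * v) ≡ 5 * p * (7 * v)
  regroup′ = solve-∀
  six-far : 6 * F ≤ 5 * P
  six-far = *-cancelʳ-≤ (6 * F) (5 * P) (7 * v) (begin
    6 * F * (7 * v)             ≤⟨ m≤n+m _ (3 * F) ⟩
    3 * F + 6 * F * (7 * v)     ≡⟨ regroup F v ⟩
    3 * (F * suc d)             ≤⟨ *-monoʳ-≤ 3 (farCount-markov d) ⟩
    3 * ∑cube m dist            ≤⟨ avgErrors ⟩
    P * m                       ≡⟨ regroup′ P v ⟩
    5 * P * (7 * v)             ∎)

total-errors : ∀ {m N R} (S : Fin (suc R) → Vec Bool m → Fin N) (dec : Fin (suc R) → Fin N → Fin m → Bool) →
  (∀ x i → 3 * (∑[ r < suc R ] mismatch (dec r (S r x) i) (lookup x i)) ≤ suc R) →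
  ∑[ r < suc R ] (3 * ∑cube m (Decoding.dist (S r) (dec r))) ≤ suc R * (2 ^ m * m)
total-errors {m} {N} {R} S dec errors = begin
  ∑[ r < R′ ] (3 * ∑cube m (λ x → ∑[ i < m ] M r x i))    ≡⟨ *-distribˡ-sum 3 (λ r → ∑cube m (λ x → ∑[ i < m ] M r x i)) ⟨
  3 * (∑[ r < R′ ] ∑cube m (λ x → ∑[ i < m ] M r x i))    ≡⟨ cong (3 *_) (∑cube-∑-comm m R′ (λ x r → ∑[ i < m ] M r x i)) ⟨
  3 * ∑cube m (λ x → ∑[ r < R′ ] ∑[ i < m ] M r x i)      ≡⟨ cong (3 *_) (∑cube-cong m (λ x → ∑-comm (M′ x))) ⟩
  3 * ∑cube m (λ x → ∑[ i < m ] ∑[ r < R′ ] M r x i)      ≡⟨ ∑cube-* m 3 _ ⟨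
  ∑cube m (λ x → 3 * (∑[ i < m ] ∑[ r < R′ ] M r x i))    ≡⟨ ∑cube-cong m (λ x → *-distribˡ-sum 3 (λ i → ∑[ r < R′ ] M r x i)) ⟩
  ∑cube m (λ x → ∑[ i < m ] (3 * ∑[ r < R′ ] M r x i))    ≤⟨ ∑cube-mono m (λ x → ∑-mono (errors x)) ⟩
  ∑cube m (λ x → ∑[ i < m ] R′)                          ≡⟨ ∑cube-cong m (λ x → ∑-const m R′) ⟩
  ∑cube m (λ x → m * R′)                                 ≡⟨ ∑cube-const m (m * R′) ⟩
  2 ^ m * (m * R′)                                       ≡⟨ rotate (2 ^ m) m R′ ⟩
  R′ * (2 ^ m * m)                                       ∎
  where
  open ≤-Reasoning
  R′ : ℕ
  R′ = suc R
  M : Fin R′ → Vec Bool m → Fin m → ℕ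
  M r x i = mismatch (dec r (S r x) i) (lookup x i)
  M′ : Vec Bool m → Fin R′ → Fin m → ℕ
  M′ x r i = M r x i
  rotate : ∀ a b c → a * (b * c) ≡ c * (a * b)
  rotate = solve-∀

^-distribʳ-* : ∀ a b u → (a * b) ^ u ≡ a ^ u * b ^ u
^-distribʳ-* a b zero = refl
^-distribʳ-* a b (suc u) = trans (cong (a * b *_) (^-distribʳ-* a b u)) ([m*n]*[o*p]≡[m*o]*[n*p] a b (a ^ u) (b ^ u))

2^-reflects-≤ : ∀ {u v} → 2 ^ u ≤ 2 ^ v → u ≤ v
2^-reflects-≤ {u} {v} le with u ≤? v
... | yes u≤v = u≤v
... | no  u≰v = contradiction le (<⇒≱ (^-monoʳ-< 2 (s≤s (s≤s z≤n)) (≰⇒> u≰v)))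

-- The constants 35 and 14 are chosen so that 2 (3/2)^14 (5/3)^35 ≤ 2^35: the cube {0,1}^(35u)
-- has at least 2^u times as many points as a Hamming ball of radius 14u.
numeric : 2 * 5 ^ 35 ≤ 2 ^ 35 * 2 ^ 14 * 3 ^ 21
numeric = toWitness {a? = 2 * 5 ^ 35 ≤? 2 ^ 35 * 2 ^ 14 * 3 ^ 21} tt

exponent-bound : ∀ u s → 2 ^ (35 * u) * (2 ^ (14 * u) * 3 ^ (35 * u)) ≤ 6 * (3 ^ (14 * u) * (2 ^ s * 5 ^ (35 * u))) →
  u ≤ 3 + s
exponent-bound u s counting = 2^-reflects-≤ (*-cancelʳ-≤ (2 ^ u) (2 ^ (3 + s)) (F ^ u) {{m^n≢0 F u}} (begin
  2 ^ u * F ^ u                 ≡⟨ ^-distribʳ-* 2 F u ⟨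
  (2 * F) ^ u                   ≤⟨ ^-monoˡ-≤ u numeric ⟩
  Q ^ u                         ≤⟨ Q^u-bound ⟩
  6 * (2 ^ s * 5 ^ (35 * u))    ≤⟨ *-monoˡ-≤ (2 ^ s * 5 ^ (35 * u)) {6} {8} (m≤m+n 6 2) ⟩
  8 * (2 ^ s * 5 ^ (35 * u))    ≡⟨ cong (8 *_) (cong (2 ^ s *_) (^-*-assoc 5 35 u)) ⟨
  8 * (2 ^ s * F ^ u)           ≡⟨ *-assoc 8 (2 ^ s) (F ^ u) ⟨
  8 * 2 ^ s * F ^ u             ≡⟨ cong (_* F ^ u) (^-distribˡ-+-* 2 3 s) ⟨
  2 ^ (3 + s) * F ^ u           ∎))
  where
  open ≤-Reasoning
  F Q : ℕ
  F = 5 ^ 35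
  Q = 2 ^ 35 * 2 ^ 14 * 3 ^ 21
  Q^u-split : Q ^ u * 3 ^ (14 * u) ≡ 2 ^ (35 * u) * (2 ^ (14 * u) * 3 ^ (35 * u))
  Q^u-split = begin-equality
    Q ^ u * 3 ^ (14 * u)                                   ≡⟨ cong (_* 3 ^ (14 * u)) (trans (^-distribʳ-* (2 ^ 35 * 2 ^ 14) (3 ^ 21) u) (cong (_* (3 ^ 21) ^ u) (^-distribʳ-* (2 ^ 35) (2 ^ 14) u))) ⟩
    (2 ^ 35) ^ u * (2 ^ 14) ^ u * (3 ^ 21) ^ u * 3 ^ (14 * u) ≡⟨ cong₂ (λ p q → p * q * (3 ^ 21) ^ u * 3 ^ (14 * u)) (^-*-assoc 2 35 u) (^-*-assoc 2 14 u) ⟩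
    2 ^ (35 * u) * 2 ^ (14 * u) * (3 ^ 21) ^ u * 3 ^ (14 * u) ≡⟨ cong (λ p → 2 ^ (35 * u) * 2 ^ (14 * u) * p * 3 ^ (14 * u)) (^-*-assoc 3 21 u) ⟩
    2 ^ (35 * u) * 2 ^ (14 * u) * 3 ^ (21 * u) * 3 ^ (14 * u) ≡⟨ *-assoc (2 ^ (35 * u) * 2 ^ (14 * u)) (3 ^ (21 * u)) (3 ^ (14 * u)) ⟩
    2 ^ (35 * u) * 2 ^ (14 * u) * (3 ^ (21 * u) * 3 ^ (14 * u)) ≡⟨ cong (2 ^ (35 * u) * 2 ^ (14 * u) *_) (^-distribˡ-+-* 3 (21 * u) (14 * u)) ⟨
    2 ^ (35 * u) * 2 ^ (14 * u) * 3 ^ (21 * u + 14 * u)    ≡⟨ cong (λ e → 2 ^ (35 * u) * 2 ^ (14 * u) * 3 ^ e) (sym (*-distribʳ-+ u 21 14)) ⟩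
    2 ^ (35 * u) * 2 ^ (14 * u) * 3 ^ (35 * u)             ≡⟨ *-assoc (2 ^ (35 * u)) (2 ^ (14 * u)) (3 ^ (35 * u)) ⟩
    2 ^ (35 * u) * (2 ^ (14 * u) * 3 ^ (35 * u))           ∎
  Q^u-bound : Q ^ u ≤ 6 * (2 ^ s * 5 ^ (35 * u))
  Q^u-bound = *-cancelʳ-≤ _ _ (3 ^ (14 * u)) {{m^n≢0 3 (14 * u)}} (begin
    Q ^ u * 3 ^ (14 * u)                              ≡⟨ Q^u-split ⟩
    2 ^ (35 * u) * (2 ^ (14 * u) * 3 ^ (35 * u))      ≤⟨ counting ⟩
    6 * (3 ^ (14 * u) * (2 ^ s * 5 ^ (35 * u)))       ≡⟨ cong (6 *_) (*-comm (3 ^ (14 * u)) _) ⟩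
    6 * ((2 ^ s * 5 ^ (35 * u)) * 3 ^ (14 * u))       ≡⟨ *-assoc 6 (2 ^ s * 5 ^ (35 * u)) (3 ^ (14 * u)) ⟨
    6 * (2 ^ s * 5 ^ (35 * u)) * 3 ^ (14 * u)         ∎)

-- Alice holds x ∈ {0,1}^m (m = 35u) and sends one of 2^s messages
-- S r x depending on a public seed r; Bob, knowing r and a position i, outputs dec r (S r x) i.
index-lower-bound : ∀ u s R (S : Fin (suc R) → Vec Bool (35 * u) → Fin (2 ^ s))
  (dec : Fin (suc R) → Fin (2 ^ s) → Fin (35 * u) → Bool) →
  (∀ x i → 3 * (∑[ r < suc R ] mismatch (dec r (S r x) i) (lookup x i)) ≤ suc R) →
  u ≤ 3 + s
index-lower-bound zero s R S dec errors = z≤n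
index-lower-bound (suc u) s R S dec errors = exponent-bound (suc u) s (begin
  2 ^ m * (2 ^ d * 3 ^ m)              ≤⟨ *-monoˡ-≤ (2 ^ d * 3 ^ m) (mostly-near u (S r) (dec r) good-seed) ⟩
  6 * nearCount d * (2 ^ d * 3 ^ m)    ≡⟨ *-assoc 6 (nearCount d) (2 ^ d * 3 ^ m) ⟩
  6 * (nearCount d * (2 ^ d * 3 ^ m))  ≤⟨ *-monoʳ-≤ 6 (nearCount-bound d) ⟩
  6 * (3 ^ d * (2 ^ s * 5 ^ m))        ∎)
  where
  open ≤-Reasoning
  m d : ℕ
  m = 35 * suc u
  d = 14 * suc u
  seed : ∃ λ r → 3 * ∑cube m (Decoding.dist (S r) (dec r)) ≤ 2 ^ m * m
  seed = averaging R (λ r → 3 * ∑cube m (Decoding.dist (S r) (dec r))) (2 ^ m * m) (total-errors S dec errors)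
  r : Fin (suc R)
  r = proj₁ seed
  good-seed : 3 * ∑cube m (Decoding.dist (S r) (dec r)) ≤ 2 ^ m * m
  good-seed = proj₂ seed
  open Decoding (S r) (dec r)

adj-sym : ∀ {n} {E : Stream n} {u v} → Adj E u v → Adj E v u
adj-sym (inj₁ uv∈E) = inj₂ uv∈E
adj-sym (inj₂ vu∈E) = inj₁ vu∈E

last-step : ∀ {A : Set} {R : A → A → Set} a zs b → Linked R (a ∷ zs ++ [ b ]) →
  ∃ λ ℓ → ℓ ∈ a ∷ zs × R ℓ b
last-step a [] b (aRb ∷ [-]) = a , here refl , aRb
last-step a (z ∷ zs) b (_ ∷ walk) with last-step z zs b walk
... | ℓ , ℓ∈zs , ℓRb = ℓ , there ℓ∈zs , ℓRb

all-or-some : ∀ K {P Q : Fin K → Set} → (∀ j → P j ⊎ Q j) → (∀ j → P j) ⊎ ∃ Q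
all-or-some zero choice = inj₁ λ ()
all-or-some (suc K) choice with choice zero | all-or-some K (choice ∘ suc)
... | inj₂ q | _ = inj₂ (zero , q)
... | inj₁ _ | inj₂ (j , q) = inj₂ (suc j , q)
... | inj₁ p | inj₁ ps = inj₁ λ { zero → p ; (suc j) → ps j }

-- The gadget graph of the reduction

-- Corners 0, 1, 2 of a triangle, in cyclic order; gadget edges join a corner to the next one.
next : Fin 3 → Fin 3
next 0F = 1F
next 1F = 2F
next 2F = 0F

previous : Fin 3 → Fin 3
previous 0F = 2F
previous 1F = 0F
previous 2F = 1F

previous-next : ∀ ρ → previous (next ρ) ≡ ρ
previous-next 0F = refl
previous-next 1F = refl
previous-next 2F = refl

next-irreflexive : ∀ ρ → ρ ≢ next ρ
next-irreflexive 0F ()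
next-irreflexive 1F ()
next-irreflexive 2F ()

next²-irreflexive : ∀ ρ → ρ ≢ next (next ρ)
next²-irreflexive 0F ()
next²-irreflexive 1F ()
next²-irreflexive 2F ()

-- K copies of m potential triangles, embedded into the vertex set Fin n.
module Gadget (K m n : ℕ) (fits : K * (m * 3) ≤ n) where

  -- The slot (j , i , ρ) is corner ρ of triangle i in copy j.
  Slot : Set
  Slot = Fin K × Fin m × Fin 3

  corner : Slot → Fin 3
  corner (_ , _ , ρ) = ρ

  vertex : Slot → Fin n
  vertex (j , i , ρ) = Fin.inject≤ (Fin.combine j (Fin.combine i ρ)) fits

  vertex-injective : ∀ {s t} → vertex s ≡ vertex t → s ≡ t
  vertex-injective {j , i , ρ} {j′ , i′ , ρ′} e
    with refl , e′ ← combine-injective j _ j′ _ (inject≤-injective fits fits _ _ e)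
    with refl , refl ← combine-injective i ρ i′ ρ′ e′
    = refl

  following : Slot → Slot
  following (j , i , ρ) = j , i , next ρ

  following-injective : ∀ {s t} → following s ≡ following t → s ≡ t
  following-injective {s} {t} e = trans (sym (undo s)) (trans (cong preceding e) (undo t))
    where
    preceding : Slot → Slot
    preceding (j , i , ρ) = j , i , previous ρ
    undo : ∀ s → preceding (following s) ≡ s
    undo (j , i , ρ) = cong (λ ρ′ → j , i , ρ′) (previous-next ρ)

  edge : Slot → Edge n
  edge s = vertex s , vertex (following s)

  edge-not-loop : ∀ s → vertex s ≢ vertex (following s)
  edge-not-loop s e = next-irreflexive (corner s) (cong corner (vertex-injective e))

  edge-injective : ∀ {s t} → s ≢ t → ¬ SameEdge (edge s) (edge t)
  edge-injective s≢t (inj₁ (e , _)) = s≢t (vertex-injective e)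
  edge-injective {s} {t} s≢t (inj₂ (e₁ , e₂))
    with refl ← vertex-injective {s} {following t} e₁
    = next²-irreflexive (corner t) (cong corner (sym (vertex-injective e₂)))

  slots : List Slot
  slots = cartesianProduct (allFin K) (cartesianProduct (allFin m) (allFin 3))

  slots-unique : Unique slots
  slots-unique = Unique.cartesianProduct⁺ (Unique.allFin⁺ K) (Unique.cartesianProduct⁺ (Unique.allFin⁺ m) (Unique.allFin⁺ 3))

  ∈-slots : ∀ s → s ∈ slots
  ∈-slots (j , i , ρ) = ∈-cartesianProduct⁺ (∈-allFin j) (∈-cartesianProduct⁺ (∈-allFin i) (∈-allFin ρ))

  alice : Vec Bool m → Slot → Bool
  alice x (_ , i , 0F) = lookup x i
  alice x (_ , _ , suc _) = false

  bob : Fin m → Slot → Bool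
  bob i₀ (_ , _ , 0F) = false
  bob i₀ (_ , i , suc _) = ⌊ i Fin.≟ i₀ ⌋

  alice? : ∀ x s → Dec (T (alice x s))
  alice? x s = T? (alice x s)

  bob? : ∀ i₀ s → Dec (T (bob i₀ s))
  bob? i₀ s = T? (bob i₀ s)

  prefix : Vec Bool m → Stream n
  prefix x = map edge (filter (alice? x) slots)

  suffix : Fin m → Stream n
  suffix i₀ = map edge (filter (bob? i₀) slots)

  module Instance (x : Vec Bool m) (i₀ : Fin m) where

    σ : Stream n
    σ = prefix x ++ suffix i₀

    Present : Slot → Set
    Present s = T (alice x s) ⊎ T (bob i₀ s)

    -- σ lists the edges of these slots; Alice's start at corner 0, Bob's at corners 1 and 2.
    present-slots : List Slot
    present-slots = filter (alice? x) slots ++ filter (bob? i₀) slots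

    present-slots-unique : Unique present-slots
    present-slots-unique = Unique.++⁺ (Unique.filter⁺ (alice? x) slots-unique)
                                      (Unique.filter⁺ (bob? i₀) slots-unique) disjoint
      where
      disjoint : ∀ {s} → ¬ (s ∈ filter (alice? x) slots × s ∈ filter (bob? i₀) slots)
      disjoint {s} (inA , inB) = not-both s (proj₂ (∈-filter⁻ (alice? x) {xs = slots} inA)) (proj₂ (∈-filter⁻ (bob? i₀) {xs = slots} inB))
        where
        not-both : ∀ s → T (alice x s) → T (bob i₀ s) → ⊥
        not-both (_ , _ , 0F) _ ()
        not-both (_ , _ , suc _) ()

    valid : ValidStream σ
    valid rewrite sym (map-++ edge (filter (alice? x) slots) (filter (bob? i₀) slots)) =
      All.map⁺ (All.tabulate λ {s} _ → edge-not-loop s) ,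
      AllPairs.map⁺ (AllPairs.map edge-injective present-slots-unique)

    present⇒∈σ : ∀ {s} → Present s → edge s ∈ σ
    present⇒∈σ {s} (inj₁ inA) = ∈-++⁺ˡ (∈-map⁺ edge (∈-filter⁺ (alice? x) (∈-slots s) inA))
    present⇒∈σ {s} (inj₂ inB) = ∈-++⁺ʳ (prefix x) (∈-map⁺ edge (∈-filter⁺ (bob? i₀) (∈-slots s) inB))

    ∈σ⇒present : ∀ {e} → e ∈ σ → ∃ λ s → Present s × e ≡ edge s
    ∈σ⇒present e∈σ with ∈-++⁻ (prefix x) e∈σ
    ... | inj₁ e∈A with s , _ , e≡ , inA ← ∈-map∘filter⁻ edge (alice? x) {xs = slots} e∈A = s , inj₁ inA , e≡
    ... | inj₂ e∈B with s , _ , e≡ , inB ← ∈-map∘filter⁻ edge (bob? i₀) {xs = slots} e∈B = s , inj₂ inB , e≡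

    Runs-along : Slot → Fin n → Fin n → Set
    Runs-along s u v = (u ≡ vertex s × v ≡ vertex (following s)) ⊎ (u ≡ vertex (following s) × v ≡ vertex s)

    adjacent⇒edge : ∀ {u v} → Adj σ u v → ∃ λ s → Present s × Runs-along s u v
    adjacent⇒edge (inj₁ uv∈σ) with s , p , refl ← ∈σ⇒present uv∈σ = s , p , inj₁ (refl , refl)
    adjacent⇒edge (inj₂ vu∈σ) with s , p , refl ← ∈σ⇒present vu∈σ = s , p , inj₂ (refl , refl)

    ends-differ : ∀ {s t t′} → Runs-along s (vertex t) (vertex t′) → corner t ≢ corner t′
    ends-differ {s} (inj₁ (e , e′)) c≡c′ =
      next-irreflexive (corner s) (trans (cong corner (vertex-injective (sym e))) (trans c≡c′ (cong corner (vertex-injective e′))))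
    ends-differ {s} (inj₂ (e , e′)) c≡c′ =
      next-irreflexive (corner s) (trans (cong corner (vertex-injective (sym e′))) (trans (sym c≡c′) (cong corner (vertex-injective e))))

    -- If x i₀ = 0 the graph is a forest: triangle i₀ misses its edge 0 → 1, so only the
    -- corners 2 of triangle i₀ have two distinct neighbours, and no two of them are adjacent.
    module Forest (xᵢ₀≡0 : lookup x i₀ ≡ false) where

      bit-i₀-unset : ∀ {i} → T (lookup x i) → i ≡ i₀ → ⊥
      bit-i₀-unset xᵢ refl rewrite xᵢ₀≡0 = xᵢ

      consecutive : ∀ s → Present s → Present (following s) → ∃ λ j → following s ≡ (j , i₀ , 2F)
      consecutive (j , i , 0F) (inj₁ xᵢ) (inj₂ i≡i₀) = ⊥-elim (bit-i₀-unset xᵢ (toWitness i≡i₀))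
      consecutive (j , i , 0F) (inj₁ _) (inj₁ ())
      consecutive (j , i , 0F) (inj₂ ()) _
      consecutive (j , i , 1F) _ (inj₂ i≡i₀) = j , cong (λ i′ → j , i′ , 2F) (toWitness i≡i₀)
      consecutive (j , i , 1F) _ (inj₁ ())
      consecutive (j , i , 2F) (inj₂ i≡i₀) (inj₁ xᵢ) = ⊥-elim (bit-i₀-unset xᵢ (toWitness i≡i₀))
      consecutive (j , i , 2F) (inj₂ _) (inj₂ ())
      consecutive (j , i , 2F) (inj₁ ()) _

      branching : ∀ {u w₁ w₂} → Adj σ u w₁ → Adj σ u w₂ → w₁ ≢ w₂ → ∃ λ j → u ≡ vertex (j , i₀ , 2F)
      branching a₁ a₂ w₁≢w₂ with adjacent⇒edge a₁ | adjacent⇒edge a₂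
      ... | s₁ , _ , inj₁ (u≡ , w₁≡) | s₂ , _ , inj₁ (u≡′ , w₂≡)
        with refl ← vertex-injective {s₁} {s₂} (trans (sym u≡) u≡′) = ⊥-elim (w₁≢w₂ (trans w₁≡ (sym w₂≡)))
      ... | s₁ , _ , inj₂ (u≡ , w₁≡) | s₂ , _ , inj₂ (u≡′ , w₂≡)
        with refl ← following-injective {s₁} {s₂} (vertex-injective (trans (sym u≡) u≡′)) = ⊥-elim (w₁≢w₂ (trans w₁≡ (sym w₂≡)))
      ... | s₁ , p₁ , inj₁ (u≡ , _) | s₂ , p₂ , inj₂ (u≡′ , _)
        with refl ← vertex-injective {s₁} {following s₂} (trans (sym u≡) u≡′)
        with j , e ← consecutive s₂ p₂ p₁ = j , trans u≡′ (cong vertex e)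
      ... | s₁ , p₁ , inj₂ (u≡ , _) | s₂ , p₂ , inj₁ (u≡′ , _)
        with refl ← vertex-injective {s₂} {following s₁} (trans (sym u≡′) u≡)
        with j , e ← consecutive s₁ p₁ p₂ = j , trans u≡ (cong vertex e)

      -- A cycle h, y₁, …, ℓ would make both h and y₁ corners 2, which are never adjacent.
      acyclic : ∀ vs → ¬ Cycle σ vs
      acyclic _ record { rest = [] ; shape = refl ; long = s≤s () }
      acyclic _ record { rest = _ ∷ [] ; shape = refl ; long = s≤s (s≤s ()) }
      acyclic _ record { head = h ; rest = y₁ ∷ y₂ ∷ ys ; shape = refl
                       ; distinct = h≢ ∷ y₁≢ ∷ _ ; closedWalk = h~y₁ ∷ y₁~y₂ ∷ walk }
        with ℓ , ℓ∈ , ℓ~h ← last-step y₂ ys h walk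
        with j , refl ← branching h~y₁ (adj-sym ℓ~h) (All.lookup y₁≢ ℓ∈)
        with j′ , refl ← branching (adj-sym h~y₁) y₁~y₂ (All.lookup h≢ (there (here refl)))
        with _ , _ , run ← adjacent⇒edge h~y₁
        = ends-differ run refl

      fvs : ∀ k → FVS k σ
      fvs k = [] , z≤n , λ (vs , cycle , _) → acyclic vs cycle

    -- If x i₀ = 1 each copy j contains the triangle i₀, so σ has K vertex-disjoint
    -- triangles and every feedback vertex set has at least K vertices.
    module Triangles (xᵢ₀≡1 : lookup x i₀ ≡ true) where

      triangle : Fin K → List (Fin n)
      triangle j = vertex (j , i₀ , 0F) ∷ vertex (j , i₀ , 1F) ∷ vertex (j , i₀ , 2F) ∷ []

      -- The three edges of triangle i₀ are present: one from Alice, two from Bob.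
      triangle-edge : ∀ j ρ → Adj σ (vertex (j , i₀ , ρ)) (vertex (j , i₀ , next ρ))
      triangle-edge j 0F = inj₁ (present⇒∈σ (inj₁ (subst T (sym xᵢ₀≡1) tt)))
      triangle-edge j 1F = inj₁ (present⇒∈σ (inj₂ (fromWitness refl)))
      triangle-edge j 2F = inj₁ (present⇒∈σ (inj₂ (fromWitness refl)))

      triangle-cycle : ∀ j → Cycle σ (triangle j)
      triangle-cycle j = record
        { head = vertex (j , i₀ , 0F) ; rest = vertex (j , i₀ , 1F) ∷ vertex (j , i₀ , 2F) ∷ []
        ; shape = refl ; long = s≤s (s≤s (s≤s z≤n))
        ; distinct = (corners≢ (λ ()) ∷ corners≢ (λ ()) ∷ []) ∷ (corners≢ (λ ()) ∷ []) ∷ [] ∷ []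
        ; closedWalk = triangle-edge j 0F ∷ triangle-edge j 1F ∷ triangle-edge j 2F ∷ [-] }
        where
        corners≢ : ∀ {ρ ρ′} → ρ ≢ ρ′ → vertex (j , i₀ , ρ) ≢ vertex (j , i₀ , ρ′)
        corners≢ ρ≢ρ′ e = ρ≢ρ′ (cong corner (vertex-injective e))

      open import Data.List.Membership.DecPropositional (Fin._≟_ {n}) using (_∈?_)

      hit-or-avoid : ∀ V′ j → (∃ λ ρ → vertex (j , i₀ , ρ) ∈ V′) ⊎ All (λ v → ¬ v ∈ V′) (triangle j)
      hit-or-avoid V′ j with vertex (j , i₀ , 0F) ∈? V′ | vertex (j , i₀ , 1F) ∈? V′ | vertex (j , i₀ , 2F) ∈? V′
      ... | yes h | _     | _     = inj₁ (0F , h)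
      ... | no _  | yes h | _     = inj₁ (1F , h)
      ... | no _  | no _  | yes h = inj₁ (2F , h)
      ... | no a  | no b  | no c  = inj₂ (a ∷ b ∷ c ∷ [])

      -- By pigeonhole, a set of k < K vertices misses one of the K disjoint triangles.
      no-fvs : ∀ k → k < K → ¬ FVS k σ
      no-fvs k k<K (V′ , |V′|≤k , acyclic) with all-or-some K (hit-or-avoid V′)
      ... | inj₂ (j , avoids) = acyclic (triangle j , triangle-cycle j , avoids)
      ... | inj₁ hits
        with j₁ , j₂ , j₁<j₂ , same-position ← pigeonhole (≤-<-trans |V′|≤k k<K) (λ j → index (proj₂ (hits j)))
        = <-irreflᶠ (cong proj₁ (vertex-injective same-vertex)) j₁<j₂
        where
        -- two copies hit V′ in the same position, hence in the same vertex
        same-vertex : vertex (j₁ , i₀ , proj₁ (hits j₁)) ≡ vertex (j₂ , i₀ , proj₁ (hits j₂))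
        same-vertex = trans (lookup-index (proj₂ (hits j₁)))
                            (trans (cong (List.lookup V′) same-position) (sym (lookup-index (proj₂ (hits j₂)))))

    correct-answer-reveals : ∀ {k b} → k < K → CorrectAnswer k σ b → not b ≡ lookup x i₀
    correct-answer-reveals {k} {b} k<K (yes⇒fvs , no⇒¬fvs) with lookup x i₀ in xᵢ₀
    correct-answer-reveals {b = true}  k<K (yes⇒fvs , _) | true = ⊥-elim (Triangles.no-fvs xᵢ₀ _ k<K (yes⇒fvs refl))
    correct-answer-reveals {b = false} k<K _ | true = refl
    correct-answer-reveals {b = true}  k<K _ | false = refl
    correct-answer-reveals {k} {false} k<K (_ , no⇒¬fvs) | false = ⊥-elim (no⇒¬fvs refl (Forest.fvs xᵢ₀ k))

∑-mark : ∀ {R} (f : Fin R → ℕ) c → f c ≡ 0 → sum (updateAt f c (λ _ → 1)) ≡ suc (sum f)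
∑-mark f zero fc≡0 rewrite fc≡0 = refl
∑-mark f (suc c) fc≡0 = trans (cong (f zero +_) (∑-mark (f ∘ suc) c fc≡0)) (+-suc (f zero) _)

zeros-bound : ∀ {R} (f : Fin R → ℕ) → (∀ r → f r ≤ 1) → ∀ L → Unique L → All (λ r → f r ≡ 0) L →
  sum f + length L ≤ R
zeros-bound {R} f f≤1 [] _ [] = begin
  sum f + 0          ≡⟨ +-identityʳ _ ⟩
  sum f              ≤⟨ ∑-mono f≤1 ⟩
  ∑[ r < R ] 1       ≡⟨ ∑-const R 1 ⟩
  R * 1              ≡⟨ *-identityʳ R ⟩
  R                  ∎
  where open ≤-Reasoning
zeros-bound {R} f f≤1 (c ∷ L) (c∉L ∷ L-unique) (fc≡0 ∷ zeros) = begin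
  sum f + suc (length L)   ≡⟨ +-suc _ _ ⟩
  suc (sum f) + length L   ≡⟨ cong (_+ length L) (∑-mark f c fc≡0) ⟨
  sum f′ + length L        ≤⟨ zeros-bound f′ f′≤1 L L-unique (All.zipWith still-zero (c∉L , zeros)) ⟩
  R                        ∎
  where
  open ≤-Reasoning
  f′ : Fin R → ℕ
  f′ = updateAt f c (λ _ → 1)
  f′≤1 : ∀ r → f′ r ≤ 1
  f′≤1 r with r Fin.≟ c
  ... | yes refl = ≤-reflexive (updateAt-updates c f)
  ... | no  r≢c  = ≤-trans (≤-reflexive (updateAt-minimal r c f r≢c)) (f≤1 r)
  still-zero : ∀ {r} → c ≢ r × f r ≡ 0 → f′ r ≡ 0
  still-zero {r} (c≢r , fr≡0) = trans (updateAt-minimal r c f (c≢r ∘ sym)) fr≡0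

error-third : ∀ {R} (f : Fin R → ℕ) → (∀ r → f r ≤ 1) → ∀ good → Unique good →
  2 * R ≤ 3 * length good → All (λ r → f r ≡ 0) good → 3 * sum f ≤ R
error-third {R} f f≤1 good unique twoThirds zeros = +-cancelʳ-≤ (2 * R) (3 * sum f) R (begin
  3 * sum f + 2 * R              ≤⟨ +-monoʳ-≤ (3 * sum f) twoThirds ⟩
  3 * sum f + 3 * length good    ≡⟨ *-distribˡ-+ 3 (sum f) (length good) ⟨
  3 * (sum f + length good)      ≤⟨ *-monoʳ-≤ 3 (zeros-bound f f≤1 good unique zeros) ⟩
  3 * R                          ≡⟨⟩
  R + 2 * R                      ∎)
  where open ≤-Reasoning

-- The reduction from INDEX: Alice runs the algorithm on her prefix and sends the memory
-- state; Bob resumes the run on his suffix and negates the answer, which reveals x i₀.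
module Reduction {k n s R} (A : RandStreamAlg n s (suc R)) (m : ℕ) (fits : suc k * (m * 3) ≤ n) where

  open Gadget (suc k) m n fits

  message : Fin (suc R) → Vec Bool m → Fin (2 ^ s)
  message r x = run A r (prefix x)

  decode : Fin (suc R) → Fin (2 ^ s) → Fin m → Bool
  decode r state i₀ = not (answer A r (foldl (update A r) state (suffix i₀)))

  decode-message : ∀ r x i₀ → decode r (message r x) i₀ ≡ not (answer A r (run A r (Instance.σ x i₀)))
  decode-message r x i₀ = cong (not ∘ answer A r) (sym (foldl-++ (update A r) (init A r) (prefix x) (suffix i₀)))

  protocol-errors : SolvesFVS k A →
    ∀ x i₀ → 3 * (∑[ r < suc R ] mismatch (decode r (message r x) i₀) (lookup x i₀)) ≤ suc R
  protocol-errors solves x i₀ with good , unique , twoThirds , correct ← solves (Instance.σ x i₀) (Instance.valid x i₀) =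
    error-third (λ r → mismatch (decode r (message r x) i₀) (lookup x i₀)) (λ r → mismatch≤1 _ _)
                good unique twoThirds (All.map (λ {r} → good-seed r) correct)
    where
    open Instance x i₀
    good-seed : ∀ r → CorrectAnswer k σ (answer A r (run A r σ)) → mismatch (decode r (message r x) i₀) (lookup x i₀) ≡ 0
    good-seed r correct-r = begin
      mismatch (decode r (message r x) i₀) (lookup x i₀)          ≡⟨ cong (λ b → mismatch b (lookup x i₀)) (decode-message r x i₀) ⟩
      mismatch (not (answer A r (run A r σ))) (lookup x i₀)       ≡⟨ cong (mismatch _) (correct-answer-reveals (n<1+n k) correct-r) ⟨
      mismatch (not (answer A r (run A r σ))) (not (answer A r (run A r σ))) ≡⟨ mismatch-refl _ ⟩
      0 ∎
      where open ≡-Reasoning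

psa-lower-bound : ∀ k n s R u (A : RandStreamAlg n s (suc R)) → SolvesFVS k A → suc k * (35 * u * 3) ≤ n → u ≤ 3 + s
psa-lower-bound k n s R u A solves fits = index-lower-bound u s R message decode (protocol-errors solves)
  where open Reduction {k} A (35 * u) fits

successor-≤-triple : ∀ u s → 5 ≤ u → u ≤ 3 + s → suc u ≤ 3 * s
successor-≤-triple u s 5≤u u≤3+s with +-cancelˡ-≤ 3 2 s (≤-trans 5≤u u≤3+s)
... | s≤s (s≤s {n = t} _) = begin
  suc u                ≤⟨ s≤s u≤3+s ⟩
  6 + t                ≤⟨ +-monoʳ-≤ 6 (m≤n*m t 3) ⟩
  6 + 3 * t            ≡⟨ *-distribˡ-+ 3 2 t ⟨
  3 * (2 + t)          ∎
  where open ≤-Reasoning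

-- Choosing u = ⌊n / 105(k+1)⌋ ≥ 5 in psa-lower-bound gives n < (u + 1) · 105(k+1) ≤ 315(k+1) s.
linear-bound : ∀ k n s R (A : RandStreamAlg n s (suc R)) → SolvesFVS k A →
  5 * (105 * suc k) ≤ n → n ≤ 3 * (105 * suc k) * s
linear-bound k n s R A solves n-large = begin
  n                  <⟨ m<[m/n+1]*n ⟩
  suc u * D          ≤⟨ *-monoˡ-≤ D (successor-≤-triple u s 5≤u (psa-lower-bound k n s R u A solves fits)) ⟩
  3 * s * D          ≡⟨ rotate 3 s D ⟩
  3 * D * s          ∎
  where
  open ≤-Reasoning
  D u : ℕ
  D = 105 * suc k
  u = n / D
  rotate : ∀ a b c → a * b * c ≡ a * c * b
  rotate = solve-∀
  copies : ∀ u k → suc k * (35 * u * 3) ≡ u * (105 * suc k)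
  copies = solve-∀
  fits : suc k * (35 * u * 3) ≤ n
  fits = ≤-trans (≤-reflexive (copies u k)) (m/n*n≤m n D)
  5≤u : 5 ≤ u
  5≤u = subst (_≤ u) (m*n/n≡m 5 D) (/-monoˡ-≤ D n-large)
  m<[m/n+1]*n : n < suc u * D
  m<[m/n+1]*n = begin-strict
    n                ≡⟨ m≡m%n+[m/n]*n n D ⟩
    n % D + u * D    <⟨ +-monoˡ-< (u * D) (m%n<n n D) ⟩
    D + u * D        ∎

theorem6 : (k : ℕ) → Σ ℕ λ c → Σ ℕ λ n₀ →
    ∀ (n s R : ℕ) → n₀ ≤ n → .{{_ : NonZero R}} →
    (A : RandStreamAlg n s R) → SolvesFVS k A → n ≤ c * s
theorem6 k = 3 * (105 * suc k) , 5 * (105 * suc k) , bound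
  where
  bound : ∀ (n s R : ℕ) → 5 * (105 * suc k) ≤ n → .{{_ : NonZero R}} →
    (A : RandStreamAlg n s R) → SolvesFVS k A → n ≤ 3 * (105 * suc k) * s
  bound n s zero _ _ _ = ⊥-elim (≢-nonZero⁻¹ 0 refl)
  bound n s (suc R) n-large A solves = linear-bound k n s R A solves n-large
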